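{- Let $n$ be an even positive integer. For an integer $0\le r\le n/2$ let $$p_r:=\Pr\left(\{\pi(1),\pi(2),\dots,\pi(n-r)\}\cap\{2i-1,2i\}\ne\emptyset\text{ for every }1\le i\le n/2\right),$$ where $\pi\in S_n$ is chosen uniformly at random. Then $p_r=1-o(1)$ if $r=o(\sqrt n)$, and $p_r=o(1)$ if $r=\omega(\sqrt n)$.
   Context: $r=r(n)$ and asymptotics are as $n\to\infty$. -}

module Defs where

open import Data.Bool using (Bool; true; false; _∧_; _∨_; not)
open import Data.Nat using (ℕ; zero; suc; _+_; _*_; _∸_; _≤_; _<_; _^_; _/_; _!; _≡ᵇ_; _≤ᵇ_)
open import Data.Nat.Properties using (_!≢0)
open import Data.Fin using (Fin; toℕ)
open import Data.Vec using (Vec; []; _∷_; lookup)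
open import Data.List using (List; []; _∷_; concatMap; map; length; filterᵇ; upTo; allFin)
open import Data.Bool.ListAction using () renaming (all to allL; any to anyL)
open import Data.Integer using (+_)
open import Data.Rational using (ℚ) renaming (_/_ to _÷_)

allVecs : (m k : ℕ) → List (Vec (Fin m) k)
allVecs m zero    = [] ∷ []
allVecs m (suc k) = concatMap (λ x → map (x ∷_) (allVecs m k)) (allFin m)

-- a vector of length n over Fin n is a permutation π (π(j+1) = lookup v j) iff its entries are distinct
isPerm : ∀ {n} → Vec (Fin n) n → Bool
isPerm {n} v = allL (λ i → allL (λ j → (toℕ i ≡ᵇ toℕ j) ∨ not (toℕ (lookup v i) ≡ᵇ toℕ (lookup v j))) (allFin n)) (allFin n)

-- permutations of {1..n} (encoded 0-based as Fin n)
perms : (n : ℕ) → List (Vec (Fin n) n)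
perms n = filterᵇ isPerm (allVecs n n)

-- The event: {π(1),…,π(n-r)} ∩ {2i-1,2i} ≠ ∅ for every 1 ≤ i ≤ n/2.
-- 0-based: for every i < n/2 there is j < n-r with π_j ∈ {2i, 2i+1}.
good : ∀ {n} → ℕ → Vec (Fin n) n → Bool
good {n} r v =
  allL (λ i → anyL (λ j → (toℕ (lookup v j) ≡ᵇ 2 * i) ∨ (toℕ (lookup v j) ≡ᵇ 2 * i + 1))
                   (filterᵇ (λ j → suc (toℕ j) ≤ᵇ (n ∸ r)) (allFin n)))
       (upTo (n / 2))

prob : (n r : ℕ) → ℚ
prob n r = (+ length (filterᵇ (good r) (perms n))) ÷ (n !) where instance _ = n !≢0

ℕ→ℚ : ℕ → ℚ
ℕ→ℚ k = (+ k) ÷ 1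

open import Data.Product using (∃-syntax)
import Data.Rational as Q

-- Asymptotics along even n = 2m, m → ∞.
-- r = o(√n):  for every ε > 0, eventually r(n) ≤ ε √n, i.e. r(n)² ≤ ε² n (both sides ≥ 0).
LittleOSqrt : (ℕ → ℕ) → Set
LittleOSqrt r = ∀ (ε : ℚ) → Q.0ℚ Q.< ε → ∃[ N ] ∀ m → N ≤ m →
  ℕ→ℚ (r (2 * m)) Q.* ℕ→ℚ (r (2 * m)) Q.≤ ε Q.* ε Q.* ℕ→ℚ (2 * m)

-- r = ω(√n):  for every M > 0, eventually r(n) ≥ M √n, i.e. r(n)² ≥ M² n.
OmegaSqrt : (ℕ → ℕ) → Set
OmegaSqrt r = ∀ (M : ℚ) → Q.0ℚ Q.< M → ∃[ N ] ∀ m → N ≤ m →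
  M Q.* M Q.* ℕ→ℚ (2 * m) Q.≤ ℕ→ℚ (r (2 * m)) Q.* ℕ→ℚ (r (2 * m))

IsLittleO1 : (ℕ → ℚ) → Set
IsLittleO1 f = ∀ (ε : ℚ) → Q.0ℚ Q.< ε → ∃[ N ] ∀ m → N ≤ m → Q.∣ f (2 * m) ∣ Q.< ε

-- A permutation π is good iff its last r values contain no pair {2i − 1, 2i}: the
-- first n − r values meet every pair exactly when their complement, the last r
-- values, contains none. Choosing the last r values one at a time, each one rules
-- out itself and its partner, so there are n (n − 2) ⋯ (n − 2r + 2) choices for them
-- and (n − r)! for the rest; hence p_r = ∏_{j<r} (n − 2j) / (n − j). Induction on r
-- gives 1 − r² / n ≤ p_r ≤ n / (n + r (r − 1) / 2), which tends to 1 when r = o(√n)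
-- and to 0 when r = ω(√n).

module Submission where

import Algebra.Solver.IdempotentCommutativeMonoid as IdempotentCommutativeMonoidSolver
open import Data.Bool using (Bool; true; false; _∧_; _∨_; not; T)
open import Data.Bool.ListAction using (all; any)
open import Data.Bool.Properties using (∧-idempotentCommutativeMonoid; ∧-assoc; ∧-identityʳ; T-∧; T-∨)
open import Data.Empty using (⊥; ⊥-elim)
open import Data.Fin using (Fin; toℕ; fromℕ<) renaming (zero to fzero; suc to fsuc)
open import Data.Fin.Properties using (toℕ<n; toℕ-fromℕ<)
open import Data.List using (List; []; _∷_; _++_; [_]; map; concatMap; length; filterᵇ; upTo; allFin)
open import Data.List.Membership.Propositional using (_∈_; find; lose)
open import Data.List.Membership.Propositional.Properties using (∈-++⁻; ∈-allFin; ∈-upTo⁺; ∈-upTo⁻)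
open import Data.List.Properties using (map-tabulate; length-tabulate; length-++; ++-identityʳ)
open import Data.List.Relation.Unary.All as All using (All; []; _∷_)
import Data.List.Relation.Unary.All.Properties as All
import Data.List.Relation.Unary.Any.Properties as Any
open import Data.List.Relation.Unary.Any using (here; there)
import Data.Integer as ℤ
import Data.Integer.Properties as ℤ
open import Data.Nat using (ℕ; zero; suc; pred; _+_; _*_; _∸_; _/_; _≤_; _<_; _≡ᵇ_; _≤ᵇ_; _!; z≤n; s≤s; NonZero; >-nonZero)
open import Data.Nat.DivMod using (m*n/n≡m)
open import Data.Nat.Properties
open import Data.Nat.Solver using (module +-*-Solver)
open import Data.List.Membership.DecPropositional _≟_ using (_∈?_)
open import Data.Product as Product using (_×_; _,_; proj₁; proj₂; ∃; ∃₂; ∃-syntax)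
open import Data.Rational using (mkℚ; toℚᵘ) renaming (_/_ to _÷_)
import Data.Rational as Q
import Data.Rational.Properties as Q
open import Data.Rational.Unnormalised using (mkℚᵘ; *≤*; *<*) renaming (_≃_ to _≃ᵘ_)
import Data.Rational.Unnormalised.Properties as Qᵘ
open import Data.Sum as Sum using (_⊎_; inj₁; inj₂)
open import Data.Vec using (Vec; []; _∷_; lookup) renaming (_++_ to _++ᵛ_)
open import Function using (_∘_; id; Equivalence)
open import Level using (Level)
open import Relation.Binary.PropositionalEquality hiding ([_])
open import Relation.Nullary using (¬_)
open import Relation.Nullary.Decidable using (decidable-stable)

open import Defs

module ∧-Solver = IdempotentCommutativeMonoidSolver ∧-idempotentCommutativeMonoid
open ∧-Solver using (_⊕_; _⊜_)
open +-*-Solver using (solve; _:+_; _:*_; _:=_; con)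

private
  variable
    ℓ ℓ′ : Level
    A : Set ℓ
    B : Set ℓ′

-- Finite sums

𝟙 : Bool → ℕ
𝟙 true  = 1
𝟙 false = 0

𝟙-∧ : ∀ b c → 𝟙 (b ∧ c) ≡ 𝟙 b * 𝟙 c
𝟙-∧ true  c = sym (+-identityʳ (𝟙 c))
𝟙-∧ false c = refl

𝟙-*-cong : ∀ b {m n} → (T b → m ≡ n) → 𝟙 b * m ≡ 𝟙 b * n
𝟙-*-cong true  m≡n = cong (_+ 0) (m≡n _)
𝟙-*-cong false m≡n = refl

∑ : (A → ℕ) → List A → ℕ
∑ f []       = 0
∑ f (x ∷ xs) = f x + ∑ f xs

∑-cong : ∀ {f g : A → ℕ} → (∀ x → f x ≡ g x) → ∀ xs → ∑ f xs ≡ ∑ g xs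
∑-cong f≗g []       = refl
∑-cong f≗g (x ∷ xs) = cong₂ _+_ (f≗g x) (∑-cong f≗g xs)

∑-0 : ∀ (xs : List A) → ∑ (λ _ → 0) xs ≡ 0
∑-0 []       = refl
∑-0 (x ∷ xs) = ∑-0 xs

∑-++ : ∀ (f : A → ℕ) xs ys → ∑ f (xs ++ ys) ≡ ∑ f xs + ∑ f ys
∑-++ f []       ys = refl
∑-++ f (x ∷ xs) ys = trans (cong (f x +_) (∑-++ f xs ys)) (sym (+-assoc (f x) _ _))

∑-map : ∀ (f : B → ℕ) (g : A → B) xs → ∑ f (map g xs) ≡ ∑ (f ∘ g) xs
∑-map f g []       = refl
∑-map f g (x ∷ xs) = cong (f (g x) +_) (∑-map f g xs)

∑-concatMap : ∀ (f : B → ℕ) (g : A → List B) xs → ∑ f (concatMap g xs) ≡ ∑ (∑ f ∘ g) xs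
∑-concatMap f g []       = refl
∑-concatMap f g (x ∷ xs) = trans (∑-++ f (g x) _) (cong (∑ f (g x) +_) (∑-concatMap f g xs))

∑-+ : ∀ (f g : A → ℕ) xs → ∑ (λ x → f x + g x) xs ≡ ∑ f xs + ∑ g xs
∑-+ f g []       = refl
∑-+ f g (x ∷ xs) = trans (cong (f x + g x +_) (∑-+ f g xs))
  (solve 4 (λ a b c d → a :+ b :+ (c :+ d) := a :+ c :+ (b :+ d)) refl (f x) (g x) (∑ f xs) (∑ g xs))

∑-*ˡ : ∀ c (f : A → ℕ) xs → ∑ (λ x → c * f x) xs ≡ c * ∑ f xs
∑-*ˡ c f []       = sym (*-zeroʳ c)
∑-*ˡ c f (x ∷ xs) = trans (cong (c * f x +_) (∑-*ˡ c f xs)) (sym (*-distribˡ-+ c (f x) _))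

∑-*ʳ : ∀ c (f : A → ℕ) xs → ∑ (λ x → f x * c) xs ≡ ∑ f xs * c
∑-*ʳ c f []       = refl
∑-*ʳ c f (x ∷ xs) = trans (cong (f x * c +_) (∑-*ʳ c f xs)) (sym (*-distribʳ-+ c (f x) _))

∑-1 : ∀ (xs : List A) → ∑ (λ _ → 1) xs ≡ length xs
∑-1 []       = refl
∑-1 (x ∷ xs) = cong suc (∑-1 xs)

∑-comm : ∀ (f : A → B → ℕ) xs ys → ∑ (λ x → ∑ (f x) ys) xs ≡ ∑ (λ y → ∑ (λ x → f x y) xs) ys
∑-comm f []       ys = sym (∑-0 ys)
∑-comm f (x ∷ xs) ys =
  trans (cong (∑ (f x) ys +_) (∑-comm f xs ys)) (sym (∑-+ (f x) (λ y → ∑ (λ x → f x y) xs) ys))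

length-filterᵇ : ∀ (p : A → Bool) xs → length (filterᵇ p xs) ≡ ∑ (𝟙 ∘ p) xs
length-filterᵇ p []       = refl
length-filterᵇ p (x ∷ xs) with p x
... | true  = cong suc (length-filterᵇ p xs)
... | false = length-filterᵇ p xs

∑-filterᵇ : ∀ (p q : A → Bool) xs → ∑ (𝟙 ∘ q) (filterᵇ p xs) ≡ ∑ (λ x → 𝟙 (p x ∧ q x)) xs
∑-filterᵇ p q []       = refl
∑-filterᵇ p q (x ∷ xs) with p x
... | true  = cong (𝟙 (q x) +_) (∑-filterᵇ p q xs)
... | false = ∑-filterᵇ p q xs

∑-0-∈ : ∀ (f : A → ℕ) {x} xs → ∑ f xs ≡ 0 → x ∈ xs → f x ≡ 0
∑-0-∈ f (x ∷ xs) ∑≡0 (here refl) = m+n≡0⇒m≡0 (f x) ∑≡0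
∑-0-∈ f (x ∷ xs) ∑≡0 (there x∈) = ∑-0-∈ f xs (m+n≡0⇒n≡0 (f x) ∑≡0) x∈

allFin-suc : ∀ n → allFin (suc n) ≡ fzero ∷ map fsuc (allFin n)
allFin-suc n = cong (fzero ∷_) (sym (map-tabulate id fsuc))

∑-allFin-suc : ∀ {n} (f : Fin (suc n) → ℕ) → ∑ f (allFin (suc n)) ≡ f fzero + ∑ (f ∘ fsuc) (allFin n)
∑-allFin-suc {n} f = trans (cong (∑ f) (allFin-suc n)) (cong (f fzero +_) (∑-map f fsuc (allFin n)))

∑-𝟙-≡ᵇ : ∀ {N} z (g : ℕ → Bool) → z < N → ∑ (λ x → 𝟙 ((toℕ x ≡ᵇ z) ∧ g (toℕ x))) (allFin N) ≡ 𝟙 (g z)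
∑-𝟙-≡ᵇ {suc N} zero g _ = begin
  ∑ (λ x → 𝟙 ((toℕ x ≡ᵇ 0) ∧ g (toℕ x))) (allFin (suc N))  ≡⟨ ∑-allFin-suc {N} _ ⟩
  𝟙 (g 0) + ∑ (λ _ → 0) (allFin N)                        ≡⟨ cong (𝟙 (g 0) +_) (∑-0 (allFin N)) ⟩
  𝟙 (g 0) + 0                                             ≡⟨ +-identityʳ _ ⟩
  𝟙 (g 0)                                                 ∎
  where open ≡-Reasoning
∑-𝟙-≡ᵇ {suc N} (suc z) g (s≤s z<N) =
  trans (∑-allFin-suc {N} (λ x → 𝟙 ((toℕ x ≡ᵇ suc z) ∧ g (toℕ x)))) (∑-𝟙-≡ᵇ z (g ∘ suc) z<N)

values : ∀ {N k} → Vec (Fin N) k → List ℕ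
values []      = []
values (x ∷ v) = toℕ x ∷ values v

values-++ : ∀ {N a b} (u : Vec (Fin N) a) (t : Vec (Fin N) b) → values (u ++ᵛ t) ≡ values u ++ values t
values-++ []      t = refl
values-++ (x ∷ u) t = cong (toℕ x ∷_) (values-++ u t)

length-values : ∀ {N k} (v : Vec (Fin N) k) → length (values v) ≡ k
length-values []      = refl
length-values (x ∷ v) = cong suc (length-values v)

values-< : ∀ {N k} (v : Vec (Fin N) k) → All (_< N) (values v)
values-< []      = []
values-< (x ∷ v) = toℕ<n x ∷ values-< v

∑-allVecs-suc : ∀ N k (f : Vec (Fin N) (suc k) → ℕ) →
  ∑ f (allVecs N (suc k)) ≡ ∑ (λ x → ∑ (λ v → f (x ∷ v)) (allVecs N k)) (allFin N)
∑-allVecs-suc N k f =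
  trans (∑-concatMap f _ (allFin N)) (∑-cong (λ x → ∑-map f (x ∷_) (allVecs N k)) (allFin N))

∑-allVecs-++ : ∀ N a b (f : Vec (Fin N) (a + b) → ℕ) →
  ∑ f (allVecs N (a + b)) ≡ ∑ (λ u → ∑ (λ t → f (u ++ᵛ t)) (allVecs N b)) (allVecs N a)
∑-allVecs-++ N zero    b f = sym (+-identityʳ _)
∑-allVecs-++ N (suc a) b f = begin
  ∑ f (allVecs N (suc a + b))
    ≡⟨ ∑-allVecs-suc N (a + b) f ⟩
  ∑ (λ x → ∑ (λ v → f (x ∷ v)) (allVecs N (a + b))) (allFin N)
    ≡⟨ ∑-cong (λ x → ∑-allVecs-++ N a b (λ v → f (x ∷ v))) (allFin N) ⟩
  ∑ (λ x → ∑ (λ u → ∑ (λ t → f (x ∷ u ++ᵛ t)) (allVecs N b)) (allVecs N a)) (allFin N)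
    ≡⟨ ∑-allVecs-suc N a _ ⟨
  ∑ (λ u → ∑ (λ t → f (u ++ᵛ t)) (allVecs N b)) (allVecs N (suc a)) ∎
  where open ≡-Reasoning

infix 7 _∉ᵇ_

_∉ᵇ_ : ℕ → List ℕ → Bool
y ∉ᵇ L = all (λ z → not (y ≡ᵇ z)) L

distinct : List ℕ → Bool
distinct []      = true
distinct (x ∷ L) = x ∉ᵇ L ∧ distinct L

disjoint : List ℕ → List ℕ → Bool
disjoint U F = all (_∉ᵇ F) U

T-not-≡ᵇ : ∀ m n → m ≢ n → T (not (m ≡ᵇ n))
T-not-≡ᵇ m n m≢n with m ≡ᵇ n in eq
... | true  = ⊥-elim (m≢n (≡ᵇ⇒≡ m n (subst T (sym eq) _)))
... | false = _

T-not-≡ᵇ⁻ : ∀ m n → T (not (m ≡ᵇ n)) → m ≢ n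
T-not-≡ᵇ⁻ m .m h refl with m ≡ᵇ m | ≡⇒≡ᵇ m m refl
... | true | _ = h

≡ᵇ-sym : ∀ m n → (m ≡ᵇ n) ≡ (n ≡ᵇ m)
≡ᵇ-sym zero    zero    = refl
≡ᵇ-sym zero    (suc n) = refl
≡ᵇ-sym (suc m) zero    = refl
≡ᵇ-sym (suc m) (suc n) = ≡ᵇ-sym m n

∉ᵇ⁻ : ∀ {y} L → T (y ∉ᵇ L) → ¬ y ∈ L
∉ᵇ⁻ {y} (z ∷ L) h y∈ with Equivalence.to T-∧ h | y∈
... | y≢z , _   | here y≡z = T-not-≡ᵇ⁻ y z y≢z y≡z
... | _   , y∉L | there y∈L = ∉ᵇ⁻ L y∉L y∈L

∉ᵇ⁺ : ∀ {y} L → ¬ y ∈ L → T (y ∉ᵇ L)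
∉ᵇ⁺ []      _   = _
∉ᵇ⁺ {y} (z ∷ L) y∉ = Equivalence.from T-∧ (T-not-≡ᵇ y z (y∉ ∘ here) , ∉ᵇ⁺ L (y∉ ∘ there))

all-cong : ∀ {p q : A → Bool} → (∀ x → p x ≡ q x) → ∀ xs → all p xs ≡ all q xs
all-cong p≗q []       = refl
all-cong p≗q (x ∷ xs) = cong₂ _∧_ (p≗q x) (all-cong p≗q xs)

all-∧ : ∀ (p q : A → Bool) xs → all (λ x → p x ∧ q x) xs ≡ all p xs ∧ all q xs
all-∧ p q []       = refl
all-∧ p q (x ∷ xs) = trans (cong ((p x ∧ q x) ∧_) (all-∧ p q xs))
  (∧-Solver.solve 4 (λ a b c d → ((a ⊕ b) ⊕ (c ⊕ d)) ⊜ ((a ⊕ c) ⊕ (b ⊕ d))) refl (p x) (q x) (all p xs) (all q xs))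

all-map : ∀ (p : B → Bool) (f : A → B) xs → all p (map f xs) ≡ all (p ∘ f) xs
all-map p f []       = refl
all-map p f (x ∷ xs) = cong (p (f x) ∧_) (all-map p f xs)

any-map : ∀ (p : B → Bool) (f : A → B) xs → any p (map f xs) ≡ any (p ∘ f) xs
any-map p f []       = refl
any-map p f (x ∷ xs) = cong (p (f x) ∨_) (any-map p f xs)

all-allFin-suc : ∀ {k} (p : Fin (suc k) → Bool) → all p (allFin (suc k)) ≡ p fzero ∧ all (p ∘ fsuc) (allFin k)
all-allFin-suc {k} p = trans (cong (all p) (allFin-suc k)) (cong (p fzero ∧_) (all-map p fsuc (allFin k)))

∉ᵇ-++ : ∀ y U F → y ∉ᵇ (U ++ F) ≡ y ∉ᵇ U ∧ y ∉ᵇ F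
∉ᵇ-++ y []      F = refl
∉ᵇ-++ y (z ∷ U) F = trans (cong (not (y ≡ᵇ z) ∧_) (∉ᵇ-++ y U F)) (sym (∧-assoc (not (y ≡ᵇ z)) _ _))

disjoint-++ʳ : ∀ U F G → disjoint U (F ++ G) ≡ disjoint U F ∧ disjoint U G
disjoint-++ʳ U F G = trans (all-cong (λ y → ∉ᵇ-++ y F G) U) (all-∧ (_∉ᵇ F) (_∉ᵇ G) U)

disjoint-[]ʳ : ∀ U → disjoint U [] ≡ true
disjoint-[]ʳ []      = refl
disjoint-[]ʳ (x ∷ U) = disjoint-[]ʳ U

disjoint-comm : ∀ U F → disjoint U F ≡ disjoint F U
disjoint-comm []      F = sym (disjoint-[]ʳ F)
disjoint-comm (x ∷ U) F = begin
  x ∉ᵇ F ∧ disjoint U F                                 ≡⟨ cong₂ _∧_ x∉F≡ (disjoint-comm U F) ⟩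
  all (λ z → not (z ≡ᵇ x)) F ∧ all (_∉ᵇ U) F           ≡⟨ all-∧ (λ z → not (z ≡ᵇ x)) (_∉ᵇ U) F ⟨
  disjoint F (x ∷ U)                                    ∎
  where
  open ≡-Reasoning
  x∉F≡ : x ∉ᵇ F ≡ all (λ z → not (z ≡ᵇ x)) F
  x∉F≡ = all-cong (λ z → cong not (≡ᵇ-sym x z)) F

distinct-++ : ∀ U F → distinct (U ++ F) ≡ (disjoint U F ∧ distinct U) ∧ distinct F
distinct-++ []      F = refl
distinct-++ (x ∷ U) F = trans (cong₂ _∧_ (∉ᵇ-++ x U F) (distinct-++ U F))
  (∧-Solver.solve 5 (λ a b c d e → ((a ⊕ b) ⊕ ((c ⊕ d) ⊕ e)) ⊜ (((b ⊕ c) ⊕ (a ⊕ d)) ⊕ e)) refl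
     (x ∉ᵇ U) (x ∉ᵇ F) (disjoint U F) (distinct U) (distinct F))

𝟙-T : ∀ {b} → T b → 𝟙 b ≡ 1
𝟙-T {true} _ = refl

𝟙-split : ∀ e b → 𝟙 b ≡ 𝟙 (not e ∧ b) + 𝟙 (e ∧ b)
𝟙-split true  b = refl
𝟙-split false b = sym (+-identityʳ (𝟙 b))

∑-𝟙-∉ᵇ : ∀ N L → T (distinct L) → All (_< N) L → ∑ (λ x → 𝟙 (toℕ x ∉ᵇ L)) (allFin N) ≡ N ∸ length L
∑-𝟙-∉ᵇ N []      _  _          = trans (∑-1 (allFin N)) (length-tabulate id)
∑-𝟙-∉ᵇ N (z ∷ L) dL (z<N ∷ L<N) = begin
  S′                 ≡⟨ m+n∸n≡m S′ 1 ⟨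
  S′ + 1 ∸ 1         ≡⟨ cong (λ e → S′ + e ∸ 1) E≡1 ⟨
  S′ + E ∸ 1         ≡⟨ cong (_∸ 1) S≡S′+E ⟨
  S ∸ 1              ≡⟨ cong (_∸ 1) (∑-𝟙-∉ᵇ N L (proj₂ (Equivalence.to T-∧ dL)) L<N) ⟩
  N ∸ length L ∸ 1   ≡⟨ ∸-+-assoc N (length L) 1 ⟩
  N ∸ (length L + 1) ≡⟨ cong (N ∸_) (+-comm (length L) 1) ⟩
  N ∸ suc (length L) ∎
  where
  open ≡-Reasoning
  S′ : ℕ
  S′ = ∑ (λ x → 𝟙 (toℕ x ∉ᵇ (z ∷ L))) (allFin N)
  S : ℕ
  S = ∑ (λ x → 𝟙 (toℕ x ∉ᵇ L)) (allFin N)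
  E : ℕ
  E = ∑ (λ x → 𝟙 ((toℕ x ≡ᵇ z) ∧ toℕ x ∉ᵇ L)) (allFin N)
  E≡1 : E ≡ 1
  E≡1 = trans (∑-𝟙-≡ᵇ z (_∉ᵇ L) z<N) (𝟙-T (proj₁ (Equivalence.to T-∧ dL)))
  S≡S′+E : S ≡ S′ + E
  S≡S′+E = trans (∑-cong (λ x → 𝟙-split (toℕ x ≡ᵇ z) (toℕ x ∉ᵇ L)) (allFin N)) (∑-+ _ _ (allFin N))

distinct-cover : ∀ N L → T (distinct L) → All (_< N) L → length L ≡ N → ∀ {y} → y < N → y ∈ L
distinct-cover N L dL L<N |L|≡N {y} y<N = decidable-stable (y ∈? L) λ y∉L → 1≢0 (begin
  1                                    ≡⟨ 𝟙-T (∉ᵇ⁺ L y∉L) ⟨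
  𝟙 (y ∉ᵇ L)                           ≡⟨ cong (λ z → 𝟙 (z ∉ᵇ L)) (toℕ-fromℕ< y<N) ⟨
  𝟙 (toℕ (fromℕ< y<N) ∉ᵇ L)            ≡⟨ ∑-0-∈ (λ x → 𝟙 (toℕ x ∉ᵇ L)) (allFin N) ∑≡0 (∈-allFin (fromℕ< y<N)) ⟩
  0                                    ∎)
  where
  open ≡-Reasoning
  1≢0 : 1 ≢ 0
  1≢0 ()
  ∑≡0 : ∑ (λ x → 𝟙 (toℕ x ∉ᵇ L)) (allFin N) ≡ 0
  ∑≡0 = trans (∑-𝟙-∉ᵇ N L dL L<N) (trans (cong (N ∸_) |L|≡N) (n∸n≡0 N))

-- isPerm is the case k = N.
pairwiseDistinct : ∀ {N k} → Vec (Fin N) k → Bool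
pairwiseDistinct {k = k} v =
  all (λ i → all (λ j → (toℕ i ≡ᵇ toℕ j) ∨ not (toℕ (lookup v i) ≡ᵇ toℕ (lookup v j))) (allFin k)) (allFin k)

all-lookup : ∀ {N k} (h : ℕ → Bool) (v : Vec (Fin N) k) → all (λ j → h (toℕ (lookup v j))) (allFin k) ≡ all h (values v)
all-lookup h []      = refl
all-lookup h (x ∷ v) = trans (all-allFin-suc (λ j → h (toℕ (lookup (x ∷ v) j)))) (cong (h (toℕ x) ∧_) (all-lookup h v))

pairwiseDistinct≡distinct : ∀ {N k} (v : Vec (Fin N) k) → pairwiseDistinct v ≡ distinct (values v)
pairwiseDistinct≡distinct []                = refl
pairwiseDistinct≡distinct {k = suc k} (x ∷ v) = begin
  pairwiseDistinct (x ∷ v)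
    ≡⟨ all-allFin-suc row ⟩
  row fzero ∧ all (row ∘ fsuc) (allFin k)
    ≡⟨ cong₂ _∧_ (all-allFin-suc (entry fzero)) (all-cong (λ i → all-allFin-suc (entry (fsuc i))) (allFin k)) ⟩
  all (λ j → not (toℕ x ≡ᵇ toℕ (lookup v j))) (allFin k) ∧
    all (λ i → not (toℕ (lookup v i) ≡ᵇ toℕ x) ∧ all (entry (fsuc i) ∘ fsuc) (allFin k)) (allFin k)
    ≡⟨ cong (x∉v′ ∧_) (all-∧ (λ i → not (toℕ (lookup v i) ≡ᵇ toℕ x)) _ (allFin k)) ⟩
  x∉v′ ∧ (all (λ i → not (toℕ (lookup v i) ≡ᵇ toℕ x)) (allFin k) ∧ pairwiseDistinct v)
    ≡⟨ cong₂ (λ b c → x∉v′ ∧ (b ∧ c)) x∉v″ (pairwiseDistinct≡distinct v) ⟩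
  x∉v′ ∧ (x∉v′ ∧ distinct (values v))
    ≡⟨ ∧-Solver.solve 2 (λ a b → (a ⊕ (a ⊕ b)) ⊜ (a ⊕ b)) refl x∉v′ (distinct (values v)) ⟩
  x∉v′ ∧ distinct (values v)
    ≡⟨ cong (_∧ distinct (values v)) (all-lookup (λ y → not (toℕ x ≡ᵇ y)) v) ⟩
  distinct (values (x ∷ v)) ∎
  where
  open ≡-Reasoning
  entry : Fin (suc k) → Fin (suc k) → Bool
  entry i j = (toℕ i ≡ᵇ toℕ j) ∨ not (toℕ (lookup (x ∷ v) i) ≡ᵇ toℕ (lookup (x ∷ v) j))
  row : Fin (suc k) → Bool
  row i = all (entry i) (allFin (suc k))
  x∉v′ : Bool
  x∉v′ = all (λ j → not (toℕ x ≡ᵇ toℕ (lookup v j))) (allFin k)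
  x∉v″ : all (λ i → not (toℕ (lookup v i) ≡ᵇ toℕ x)) (allFin k) ≡ x∉v′
  x∉v″ = all-cong (λ i → cong not (≡ᵇ-sym (toℕ (lookup v i)) (toℕ x))) (allFin k)

-- Sequences avoiding a growing forbidden list

-- With B = [_] this says that U is distinct and avoids F; with B = partners it also
-- excludes the partner of every entry.
admissible : (ℕ → List ℕ) → List ℕ → List ℕ → Bool
admissible B F []      = true
admissible B F (x ∷ U) = x ∉ᵇ F ∧ admissible B (B x ++ F) U

admissible-split : ∀ B F U → admissible B F U ≡ disjoint U F ∧ admissible B [] U
admissible-split B F []      = refl
admissible-split B F (x ∷ U) = begin
  x ∉ᵇ F ∧ admissible B (B x ++ F) U
    ≡⟨ cong (x ∉ᵇ F ∧_) (admissible-split B (B x ++ F) U) ⟩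
  x ∉ᵇ F ∧ (disjoint U (B x ++ F) ∧ admissible B [] U)
    ≡⟨ cong (λ b → x ∉ᵇ F ∧ (b ∧ admissible B [] U)) (disjoint-++ʳ U (B x) F) ⟩
  x ∉ᵇ F ∧ ((disjoint U (B x) ∧ disjoint U F) ∧ admissible B [] U)
    ≡⟨ ∧-Solver.solve 4 (λ a b c d → (a ⊕ ((b ⊕ c) ⊕ d)) ⊜ ((a ⊕ c) ⊕ (b ⊕ d))) refl
         (x ∉ᵇ F) (disjoint U (B x)) (disjoint U F) (admissible B [] U) ⟩
  (x ∉ᵇ F ∧ disjoint U F) ∧ (disjoint U (B x) ∧ admissible B [] U)
    ≡⟨ cong ((x ∉ᵇ F ∧ disjoint U F) ∧_) (trans (cong (λ G → admissible B G U) (++-identityʳ (B x))) (admissible-split B (B x) U)) ⟨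
  (x ∉ᵇ F ∧ disjoint U F) ∧ admissible B (B x ++ []) U ∎
  where open ≡-Reasoning

admissible-singleton-[] : ∀ U → admissible [_] [] U ≡ distinct U
admissible-singleton-[] []      = refl
admissible-singleton-[] (x ∷ U) = begin
  admissible [_] [ x ] U                  ≡⟨ admissible-split [_] [ x ] U ⟩
  disjoint U [ x ] ∧ admissible [_] [] U  ≡⟨ cong₂ _∧_ (disjoint-comm U [ x ]) (admissible-singleton-[] U) ⟩
  (x ∉ᵇ U ∧ true) ∧ distinct U            ≡⟨ cong (_∧ distinct U) (∧-identityʳ (x ∉ᵇ U)) ⟩
  x ∉ᵇ U ∧ distinct U                     ∎
  where open ≡-Reasoning

distinct-++-admissible : ∀ U F → distinct (U ++ F) ≡ admissible [_] F U ∧ distinct F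
distinct-++-admissible U F = begin
  distinct (U ++ F)                                        ≡⟨ distinct-++ U F ⟩
  (disjoint U F ∧ distinct U) ∧ distinct F                 ≡⟨ cong (λ b → (disjoint U F ∧ b) ∧ distinct F) (admissible-singleton-[] U) ⟨
  (disjoint U F ∧ admissible [_] [] U) ∧ distinct F        ≡⟨ cong (_∧ distinct F) (admissible-split [_] F U) ⟨
  admissible [_] F U ∧ distinct F                          ∎
  where open ≡-Reasoning

fallingBy : ℕ → ℕ → ℕ → ℕ
fallingBy d A zero    = 1
fallingBy d A (suc k) = A * fallingBy d (A ∸ d) k

module _ (N d : ℕ) (B : ℕ → List ℕ) (length-B : ∀ x → length (B x) ≡ d)
         (Inv : List ℕ → Set)
         (Inv⇒distinct : ∀ {F} → Inv F → T (distinct F))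
         (Inv⇒< : ∀ {F} → Inv F → All (_< N) F)
         (Inv-step : ∀ {x F} → x < N → T (x ∉ᵇ F) → Inv F → Inv (B x ++ F)) where

  ∑-admissible : ∀ k F → Inv F → ∑ (λ u → 𝟙 (admissible B F (values u))) (allVecs N k) ≡ fallingBy d (N ∸ length F) k
  ∑-admissible zero    F _   = refl
  ∑-admissible (suc k) F inv = begin
    ∑ (λ u → 𝟙 (admissible B F (values u))) (allVecs N (suc k))
      ≡⟨ ∑-allVecs-suc N k _ ⟩
    ∑ (λ x → ∑ (λ u → 𝟙 (toℕ x ∉ᵇ F ∧ admissible B (B (toℕ x) ++ F) (values u))) (allVecs N k)) (allFin N)
      ≡⟨ ∑-cong (λ x → trans (∑-cong (λ u → 𝟙-∧ (toℕ x ∉ᵇ F) _) (allVecs N k)) (∑-*ˡ (𝟙 (toℕ x ∉ᵇ F)) _ (allVecs N k))) (allFin N) ⟩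
    ∑ (λ x → 𝟙 (toℕ x ∉ᵇ F) * ∑ (λ u → 𝟙 (admissible B (B (toℕ x) ++ F) (values u))) (allVecs N k)) (allFin N)
      ≡⟨ ∑-cong (λ x → 𝟙-*-cong (toℕ x ∉ᵇ F) (remaining x)) (allFin N) ⟩
    ∑ (λ x → 𝟙 (toℕ x ∉ᵇ F) * fallingBy d (N ∸ length F ∸ d) k) (allFin N)
      ≡⟨ ∑-*ʳ (fallingBy d (N ∸ length F ∸ d) k) (λ x → 𝟙 (toℕ x ∉ᵇ F)) (allFin N) ⟩
    ∑ (λ x → 𝟙 (toℕ x ∉ᵇ F)) (allFin N) * fallingBy d (N ∸ length F ∸ d) k
      ≡⟨ cong (_* fallingBy d (N ∸ length F ∸ d) k) (∑-𝟙-∉ᵇ N F (Inv⇒distinct inv) (Inv⇒< inv)) ⟩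
    (N ∸ length F) * fallingBy d (N ∸ length F ∸ d) k ∎
    where
    open ≡-Reasoning
    remaining : ∀ x → T (toℕ x ∉ᵇ F) →
      ∑ (λ u → 𝟙 (admissible B (B (toℕ x) ++ F) (values u))) (allVecs N k) ≡ fallingBy d (N ∸ length F ∸ d) k
    remaining x x∉F = trans (∑-admissible k (B (toℕ x) ++ F) (Inv-step (toℕ<n x) x∉F inv)) (cong (λ m → fallingBy d m k) (begin
      N ∸ length (B (toℕ x) ++ F)   ≡⟨ cong (N ∸_) (trans (length-++ (B (toℕ x))) (cong (_+ length F) (length-B (toℕ x)))) ⟩
      N ∸ (d + length F)            ≡⟨ cong (N ∸_) (+-comm d (length F)) ⟩
      N ∸ (length F + d)            ≡⟨ ∸-+-assoc N (length F) d ⟨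
      N ∸ length F ∸ d              ∎))

∑-avoiding : ∀ N k F → T (distinct F) → All (_< N) F →
  ∑ (λ u → 𝟙 (admissible [_] F (values u))) (allVecs N k) ≡ fallingBy 1 (N ∸ length F) k
∑-avoiding N k F dF F<N = ∑-admissible N 1 [_] (λ _ → refl) (λ F → T (distinct F) × All (_< N) F) proj₁ proj₂
  (λ x<N x∉F (dF , F<N) → Equivalence.from T-∧ (x∉F , dF) , x<N ∷ F<N) k F (dF , F<N)

-- The pairs {2i, 2i+1}

partner : ℕ → ℕ
partner zero          = 1
partner (suc zero)    = 0
partner (suc (suc y)) = suc (suc (partner y))

partner-involutive : ∀ y → partner (partner y) ≡ y
partner-involutive zero          = refl
partner-involutive (suc zero)    = refl
partner-involutive (suc (suc y)) = cong (suc ∘ suc) (partner-involutive y)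

partner-≢ : ∀ y → partner y ≢ y
partner-≢ zero          ()
partner-≢ (suc zero)    ()
partner-≢ (suc (suc y)) eq = partner-≢ y (suc-injective (suc-injective eq))

partner-2* : ∀ i → partner (2 * i) ≡ 2 * i + 1
partner-2* zero    = refl
partner-2* (suc i) = begin
  partner (2 * suc i)          ≡⟨ cong partner (*-suc 2 i) ⟩
  suc (suc (partner (2 * i)))  ≡⟨ cong (suc ∘ suc) (partner-2* i) ⟩
  suc (suc (2 * i + 1))        ≡⟨ cong (_+ 1) (*-suc 2 i) ⟨
  2 * suc i + 1                ∎
  where open ≡-Reasoning

InPair : ℕ → ℕ → Set
InPair i y = (y ≡ 2 * i × partner y ≡ 2 * i + 1) ⊎ (y ≡ 2 * i + 1 × partner y ≡ 2 * i)

InPair-suc : ∀ {i y} → InPair i y → InPair (suc i) (suc (suc y))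
InPair-suc {i} = Sum.map (Product.map suc²-2* suc²-2*+1) (Product.map suc²-2*+1 suc²-2*)
  where
  suc²-2* : ∀ {z} → z ≡ 2 * i → suc (suc z) ≡ 2 * suc i
  suc²-2* eq = trans (cong (suc ∘ suc) eq) (sym (*-suc 2 i))
  suc²-2*+1 : ∀ {z} → z ≡ 2 * i + 1 → suc (suc z) ≡ 2 * suc i + 1
  suc²-2*+1 eq = trans (cong (suc ∘ suc) eq) (cong (_+ 1) (sym (*-suc 2 i)))

pair-of : ∀ M y → y < 2 * M → ∃ λ i → i < M × InPair i y
pair-of (suc M) zero          _  = 0 , s≤s z≤n , inj₁ (refl , refl)
pair-of (suc M) (suc zero)    _  = 0 , s≤s z≤n , inj₂ (refl , refl)
pair-of (suc M) (suc (suc y)) y< with pair-of M y (≤-pred (≤-pred (subst (suc (suc (suc y)) ≤_) (*-suc 2 M) y<)))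
... | i , i<M , y∈i = suc i , s≤s i<M , InPair-suc y∈i

2*<2* : ∀ {i M} → i < M → 2 * i < 2 * M
2*<2* {i} {M} = *-monoʳ-< 2 {i} {M}

2*+1<2* : ∀ {i M} → i < M → 2 * i + 1 < 2 * M
2*+1<2* {i} {M} i<M = subst (_≤ 2 * M) (trans (*-suc 2 i) (cong suc (+-comm 1 (2 * i)))) (*-monoʳ-≤ 2 i<M)

partner-< : ∀ M {y} → y < 2 * M → partner y < 2 * M
partner-< M {y} y< with pair-of M y y<
... | i , i<M , inj₁ (_ , py≡) = subst (_< 2 * M) (sym py≡) (2*+1<2* i<M)
... | i , i<M , inj₂ (_ , py≡) = subst (_< 2 * M) (sym py≡) (2*<2* i<M)

partners : ℕ → List ℕ
partners x = x ∷ partner x ∷ []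

pairFree : List ℕ → Bool
pairFree []      = true
pairFree (x ∷ L) = partner x ∉ᵇ L ∧ pairFree L

admissible-partners-[] : ∀ U → admissible partners [] U ≡ distinct U ∧ pairFree U
admissible-partners-[] []      = refl
admissible-partners-[] (x ∷ U) = begin
  admissible partners (partners x) U
    ≡⟨ admissible-split partners (partners x) U ⟩
  disjoint U (partners x) ∧ admissible partners [] U
    ≡⟨ cong₂ _∧_ (disjoint-comm U (partners x)) (admissible-partners-[] U) ⟩
  (x ∉ᵇ U ∧ (partner x ∉ᵇ U ∧ true)) ∧ (distinct U ∧ pairFree U)
    ≡⟨ ∧-Solver.solve 4 (λ a b c d → ((a ⊕ (b ⊕ ∧-Solver.id)) ⊕ (c ⊕ d)) ⊜ ((a ⊕ c) ⊕ (b ⊕ d))) refl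
         (x ∉ᵇ U) (partner x ∉ᵇ U) (distinct U) (pairFree U) ⟩
  (x ∉ᵇ U ∧ distinct U) ∧ (partner x ∉ᵇ U ∧ pairFree U) ∎
  where open ≡-Reasoning

∑-pairFree : ∀ M k →
  ∑ (λ u → 𝟙 (admissible partners [] (values u))) (allVecs (2 * M) k) ≡ fallingBy 2 (2 * M) k
∑-pairFree M k = ∑-admissible (2 * M) 2 partners (λ _ → refl) Inv proj₁ (proj₁ ∘ proj₂) step k [] (_ , [] , λ ())
  where
  -- Closure under partner makes the partner of an admissible entry fresh as well.
  Inv : List ℕ → Set
  Inv F = T (distinct F) × All (_< 2 * M) F × (∀ {y} → y ∈ F → partner y ∈ F)
  step : ∀ {x F} → x < 2 * M → T (x ∉ᵇ F) → Inv F → Inv (partners x ++ F)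
  step {x} {F} x< x∉F (dF , F< , closed) =
    Equivalence.from T-∧ (x∉px∷F , Equivalence.from T-∧ (px∉F , dF)) , x< ∷ partner-< M x< ∷ F< , closed′
    where
    x∉px∷F : T (x ∉ᵇ (partner x ∷ F))
    x∉px∷F = ∉ᵇ⁺ (partner x ∷ F) λ { (here x≡px) → partner-≢ x (sym x≡px) ; (there x∈F) → ∉ᵇ⁻ F x∉F x∈F }
    px∉F : T (partner x ∉ᵇ F)
    px∉F = ∉ᵇ⁺ F λ px∈F → ∉ᵇ⁻ F x∉F (subst (_∈ F) (partner-involutive x) (closed px∈F))
    closed′ : ∀ {y} → y ∈ partners x ++ F → partner y ∈ partners x ++ F
    closed′ (here refl)         = there (here refl)
    closed′ (there (here refl)) = here (partner-involutive x)
    closed′ (there (there y∈F)) = there (there (closed y∈F))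

pairFree⁻ : ∀ L {y} → T (pairFree L) → y ∈ L → partner y ∈ L → ⊥
pairFree⁻ (x ∷ L) pf (here refl) (here px≡x)  = partner-≢ x px≡x
pairFree⁻ (x ∷ L) pf (here refl) (there px∈L) = ∉ᵇ⁻ L (proj₁ (Equivalence.to T-∧ pf)) px∈L
pairFree⁻ (x ∷ L) {y} pf (there y∈L) (here py≡x) =
  ∉ᵇ⁻ L (proj₁ (Equivalence.to T-∧ pf)) (subst (_∈ L) (trans (sym (partner-involutive y)) (cong partner py≡x)) y∈L)
pairFree⁻ (x ∷ L) pf (there y∈L) (there py∈L) = pairFree⁻ L (proj₂ (Equivalence.to T-∧ pf)) y∈L py∈L

pairFree⁺ : ∀ L → (∀ {y} → y ∈ L → partner y ∈ L → ⊥) → T (pairFree L)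
pairFree⁺ []      _  = _
pairFree⁺ (x ∷ L) nf = Equivalence.from T-∧
  (∉ᵇ⁺ L (nf (here refl) ∘ there) , pairFree⁺ L (λ y∈L py∈L → nf (there y∈L) (there py∈L)))

distinct-++-disjoint : ∀ U F {y} → T (distinct (U ++ F)) → y ∈ U → y ∈ F → ⊥
distinct-++-disjoint U F d y∈U y∈F = ∉ᵇ⁻ F (All.lookup (All.all⁺ (_∉ᵇ F) U disjointUF) y∈U) y∈F
  where
  disjointUF : T (disjoint U F)
  disjointUF = proj₁ (Equivalence.to T-∧ (proj₁ (Equivalence.to T-∧ (subst T (distinct-++ U F) d))))

pairHit : ℕ → ℕ → Bool
pairHit i y = (y ≡ᵇ 2 * i) ∨ (y ≡ᵇ 2 * i + 1)

meetsPairs : ℕ → List ℕ → Bool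
meetsPairs M U = all (λ i → any (pairHit i) U) (upTo M)

meetsPairs⁻ : ∀ M U → T (meetsPairs M U) → ∀ {i} → i < M → 2 * i ∈ U ⊎ 2 * i + 1 ∈ U
meetsPairs⁻ M U h {i} i<M with find (Any.any⁻ (pairHit i) U (All.lookup (All.all⁺ _ (upTo M) h) (∈-upTo⁺ i<M)))
... | y , y∈U , hit = Sum.map (λ y≡ → subst (_∈ U) (≡ᵇ⇒≡ y _ y≡) y∈U) (λ y≡ → subst (_∈ U) (≡ᵇ⇒≡ y _ y≡) y∈U)
                              (Equivalence.to T-∨ hit)

meetsPairs⁺ : ∀ M U → (∀ {i} → i < M → 2 * i ∈ U ⊎ 2 * i + 1 ∈ U) → T (meetsPairs M U)
meetsPairs⁺ M U meets = All.all⁻ _ (All.tabulate λ {i} i∈ → hit {i} (meets (∈-upTo⁻ i∈)))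
  where
  hit : ∀ {i} → 2 * i ∈ U ⊎ 2 * i + 1 ∈ U → T (any (pairHit i) U)
  hit {i} (inj₁ 2i∈U)   = Any.any⁺ (pairHit i) (lose 2i∈U (Equivalence.from T-∨ (inj₁ (≡⇒≡ᵇ (2 * i) _ refl))))
  hit {i} (inj₂ 2i+1∈U) = Any.any⁺ (pairHit i) (lose 2i+1∈U (Equivalence.from T-∨ (inj₂ (≡⇒≡ᵇ (2 * i + 1) _ refl))))

meetsPairs⇒pairFree : ∀ M U F → All (_< 2 * M) F → T (distinct (U ++ F)) → T (meetsPairs M U) → T (pairFree F)
meetsPairs⇒pairFree M U F F< d meets = pairFree⁺ F pair∉F
  where
  pair∉F : ∀ {y} → y ∈ F → partner y ∈ F → ⊥
  pair∉F {y} y∈F py∈F with pair-of M y (All.lookup F< y∈F)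
  ... | i , i<M , inj₁ (y≡ , py≡) =
    Sum.[ (λ 2i∈U → distinct-++-disjoint U F d 2i∈U (subst (_∈ F) y≡ y∈F))
        , (λ 2i+1∈U → distinct-++-disjoint U F d 2i+1∈U (subst (_∈ F) py≡ py∈F)) ] (meetsPairs⁻ M U meets i<M)
  ... | i , i<M , inj₂ (y≡ , py≡) =
    Sum.[ (λ 2i∈U → distinct-++-disjoint U F d 2i∈U (subst (_∈ F) py≡ py∈F))
        , (λ 2i+1∈U → distinct-++-disjoint U F d 2i+1∈U (subst (_∈ F) y≡ y∈F)) ] (meetsPairs⁻ M U meets i<M)

pairFree⇒meetsPairs : ∀ M U F → All (_< 2 * M) (U ++ F) → length (U ++ F) ≡ 2 * M →
  T (distinct (U ++ F)) → T (pairFree F) → T (meetsPairs M U)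
pairFree⇒meetsPairs M U F U++F< |U++F| d pf = meetsPairs⁺ M U meets
  where
  covers : ∀ {y} → y < 2 * M → y ∈ U ++ F
  covers = distinct-cover (2 * M) (U ++ F) d U++F< |U++F|
  meets : ∀ {i} → i < M → 2 * i ∈ U ⊎ 2 * i + 1 ∈ U
  meets {i} i<M with ∈-++⁻ U (covers (2*<2* i<M)) | ∈-++⁻ U (covers (2*+1<2* i<M))
  ... | inj₁ 2i∈U | _           = inj₁ 2i∈U
  ... | inj₂ _    | inj₁ 2i+1∈U = inj₂ 2i+1∈U
  ... | inj₂ 2i∈F | inj₂ 2i+1∈F = ⊥-elim (pairFree⁻ F pf 2i∈F (subst (_∈ F) (sym (partner-2* i)) 2i+1∈F))

-- good r is prefixMeetsPairs (n / 2) (n ∸ r) on vectors of length n.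
prefixMeetsPairs : ∀ {N k} → ℕ → ℕ → Vec (Fin N) k → Bool
prefixMeetsPairs {k = k} M a v =
  all (λ i → any (λ j → pairHit i (toℕ (lookup v j))) (filterᵇ (λ j → suc (toℕ j) ≤ᵇ a) (allFin k))) (upTo M)

filterᵇ-map : ∀ (p : B → Bool) (g : A → B) xs → filterᵇ p (map g xs) ≡ map g (filterᵇ (p ∘ g) xs)
filterᵇ-map p g []       = refl
filterᵇ-map p g (x ∷ xs) with p (g x)
... | true  = cong (g x ∷_) (filterᵇ-map p g xs)
... | false = filterᵇ-map p g xs

filterᵇ-none : ∀ (p : A → Bool) → (∀ x → p x ≡ false) → ∀ xs → filterᵇ p xs ≡ []
filterᵇ-none p none []       = refl
filterᵇ-none p none (x ∷ xs) with p x | none x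
... | false | _ = filterᵇ-none p none xs

any-prefix : ∀ {N a b} (h : ℕ → Bool) (u : Vec (Fin N) a) (t : Vec (Fin N) b) →
  any (λ j → h (toℕ (lookup (u ++ᵛ t) j))) (filterᵇ (λ j → suc (toℕ j) ≤ᵇ a) (allFin (a + b))) ≡ any h (values u)
any-prefix {b = b} h []      t = cong (any _) (filterᵇ-none _ (λ _ → refl) (allFin b))
any-prefix {a = suc a} {b} h (x ∷ u) t = begin
  any H (filterᵇ inPrefix (allFin (suc (a + b))))
    ≡⟨ cong (any H ∘ filterᵇ inPrefix) (allFin-suc (a + b)) ⟩
  h (toℕ x) ∨ any H (filterᵇ inPrefix (map fsuc (allFin (a + b))))
    ≡⟨ cong (λ l → h (toℕ x) ∨ any H l) (filterᵇ-map inPrefix fsuc (allFin (a + b))) ⟩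
  h (toℕ x) ∨ any H (map fsuc (filterᵇ (inPrefix ∘ fsuc) (allFin (a + b))))
    ≡⟨ cong (h (toℕ x) ∨_) (any-map H fsuc (filterᵇ (inPrefix ∘ fsuc) (allFin (a + b)))) ⟩
  h (toℕ x) ∨ any (H ∘ fsuc) (filterᵇ (inPrefix ∘ fsuc) (allFin (a + b)))
    ≡⟨ cong (h (toℕ x) ∨_) (any-prefix h u t) ⟩
  h (toℕ x) ∨ any h (values u) ∎
  where
  open ≡-Reasoning
  H : Fin (suc (a + b)) → Bool
  H j = h (toℕ (lookup (x ∷ u ++ᵛ t) j))
  inPrefix : Fin (suc (a + b)) → Bool
  inPrefix j = suc (toℕ j) ≤ᵇ suc a

prefixMeetsPairs-++ : ∀ {N a b} M (u : Vec (Fin N) a) (t : Vec (Fin N) b) →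
  prefixMeetsPairs M a (u ++ᵛ t) ≡ meetsPairs M (values u)
prefixMeetsPairs-++ M u t = all-cong (λ i → any-prefix (pairHit i) u t) (upTo M)

T-ext : ∀ {a b} → (T a → T b) → (T b → T a) → a ≡ b
T-ext {true}  {true}  _   _   = refl
T-ext {true}  {false} a⇒b _   = ⊥-elim (a⇒b _)
T-ext {false} {true}  _   b⇒a = ⊥-elim (b⇒a _)
T-ext {false} {false} _   _   = refl

∧-congˡ-T : ∀ a {b c} → (T a → b ≡ c) → a ∧ b ≡ a ∧ c
∧-congˡ-T true  b≡c = b≡c _
∧-congˡ-T false _   = refl

good-split : ∀ M {a b} (u : Vec (Fin (2 * M)) a) (t : Vec (Fin (2 * M)) b) → a + b ≡ 2 * M →
  distinct (values (u ++ᵛ t)) ∧ prefixMeetsPairs M a (u ++ᵛ t) ≡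
    admissible [_] (values t) (values u) ∧ admissible partners [] (values t)
good-split M {a} u t a+b≡ = begin
  distinct (values (u ++ᵛ t)) ∧ prefixMeetsPairs M a (u ++ᵛ t)
    ≡⟨ cong₂ _∧_ (cong distinct (values-++ u t)) (prefixMeetsPairs-++ M u t) ⟩
  distinct (U ++ F) ∧ meetsPairs M U
    ≡⟨ ∧-congˡ-T (distinct (U ++ F)) (λ d →
         T-ext (meetsPairs⇒pairFree M U F (values-< t) d) (pairFree⇒meetsPairs M U F U++F< |U++F| d)) ⟩
  distinct (U ++ F) ∧ pairFree F
    ≡⟨ cong (_∧ pairFree F) (distinct-++-admissible U F) ⟩
  (admissible [_] F U ∧ distinct F) ∧ pairFree F
    ≡⟨ ∧-assoc (admissible [_] F U) (distinct F) (pairFree F) ⟩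
  admissible [_] F U ∧ (distinct F ∧ pairFree F)
    ≡⟨ cong (admissible [_] F U ∧_) (admissible-partners-[] F) ⟨
  admissible [_] F U ∧ admissible partners [] F ∎
  where
  open ≡-Reasoning
  U : List ℕ
  U = values u
  F : List ℕ
  F = values t
  U++F< : All (_< 2 * M) (U ++ F)
  U++F< = All.++⁺ (values-< u) (values-< t)
  |U++F| : length (U ++ F) ≡ 2 * M
  |U++F| = trans (length-++ U) (trans (cong₂ _+_ (length-values u) (length-values t)) a+b≡)

fallingBy-1-self : ∀ a → fallingBy 1 a a ≡ a !
fallingBy-1-self zero    = refl
fallingBy-1-self (suc a) = cong (suc a *_) (fallingBy-1-self a)

#good : ∀ M r → r ≤ 2 * M → length (filterᵇ (good r) (perms (2 * M))) ≡ (2 * M ∸ r) ! * fallingBy 2 (2 * M) r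
#good M r r≤n = begin
  length (filterᵇ (good r) (filterᵇ isPerm (allVecs n n)))
    ≡⟨ length-filterᵇ (good r) (filterᵇ isPerm (allVecs n n)) ⟩
  ∑ (𝟙 ∘ good r) (filterᵇ isPerm (allVecs n n))
    ≡⟨ ∑-filterᵇ isPerm (good r) (allVecs n n) ⟩
  ∑ (λ v → 𝟙 (isPerm v ∧ good r v)) (allVecs n n)
    ≡⟨ ∑-cong (λ v → cong 𝟙 (cong₂ _∧_ (pairwiseDistinct≡distinct v) (cong (λ m → prefixMeetsPairs m a v) n/2≡M))) (allVecs n n) ⟩
  ∑ (goodPerm {n}) (allVecs n n)
    ≡⟨ cong (λ k → ∑ (goodPerm {k}) (allVecs n k)) a+r≡n ⟨
  ∑ (goodPerm {a + r}) (allVecs n (a + r))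
    ≡⟨ ∑-allVecs-++ n a r goodPerm ⟩
  ∑ (λ u → ∑ (λ t → goodPerm (u ++ᵛ t)) (allVecs n r)) (allVecs n a)
    ≡⟨ ∑-cong (λ u → ∑-cong (λ t → cong 𝟙 (good-split M u t a+r≡n)) (allVecs n r)) (allVecs n a) ⟩
  ∑ (λ u → ∑ (λ t → 𝟙 (avoids t u ∧ pairFreeᵃ t)) (allVecs n r)) (allVecs n a)
    ≡⟨ ∑-comm (λ u t → 𝟙 (avoids t u ∧ pairFreeᵃ t)) (allVecs n a) (allVecs n r) ⟩
  ∑ (λ t → ∑ (λ u → 𝟙 (avoids t u ∧ pairFreeᵃ t)) (allVecs n a)) (allVecs n r)
    ≡⟨ ∑-cong count-prefixes (allVecs n r) ⟩
  ∑ (λ t → 𝟙 (pairFreeᵃ t) * a !) (allVecs n r)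
    ≡⟨ ∑-*ʳ (a !) (𝟙 ∘ pairFreeᵃ) (allVecs n r) ⟩
  ∑ (𝟙 ∘ pairFreeᵃ) (allVecs n r) * a !
    ≡⟨ cong (_* a !) (∑-pairFree M r) ⟩
  fallingBy 2 n r * a !
    ≡⟨ *-comm (fallingBy 2 n r) (a !) ⟩
  a ! * fallingBy 2 n r ∎
  where
  open ≡-Reasoning
  n : ℕ
  n = 2 * M
  a : ℕ
  a = n ∸ r
  a+r≡n : a + r ≡ n
  a+r≡n = m∸n+n≡m r≤n
  n/2≡M : n / 2 ≡ M
  n/2≡M = trans (cong (_/ 2) (*-comm 2 M)) (m*n/n≡m M 2)
  goodPerm : ∀ {k} → Vec (Fin n) k → ℕ
  goodPerm v = 𝟙 (distinct (values v) ∧ prefixMeetsPairs M a v)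
  avoids : Vec (Fin n) r → Vec (Fin n) a → Bool
  avoids t u = admissible [_] (values t) (values u)
  pairFreeᵃ : Vec (Fin n) r → Bool
  pairFreeᵃ t = admissible partners [] (values t)
  count-prefixes : ∀ t → ∑ (λ u → 𝟙 (avoids t u ∧ pairFreeᵃ t)) (allVecs n a) ≡ 𝟙 (pairFreeᵃ t) * a !
  count-prefixes t = begin
    ∑ (λ u → 𝟙 (avoids t u ∧ pairFreeᵃ t)) (allVecs n a)
      ≡⟨ ∑-cong (λ u → 𝟙-∧ (avoids t u) (pairFreeᵃ t)) (allVecs n a) ⟩
    ∑ (λ u → 𝟙 (avoids t u) * 𝟙 (pairFreeᵃ t)) (allVecs n a)
      ≡⟨ ∑-*ʳ (𝟙 (pairFreeᵃ t)) (𝟙 ∘ avoids t) (allVecs n a) ⟩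
    ∑ (𝟙 ∘ avoids t) (allVecs n a) * 𝟙 (pairFreeᵃ t)
      ≡⟨ *-comm _ (𝟙 (pairFreeᵃ t)) ⟩
    𝟙 (pairFreeᵃ t) * ∑ (𝟙 ∘ avoids t) (allVecs n a)
      ≡⟨ 𝟙-*-cong (pairFreeᵃ t) count ⟩
    𝟙 (pairFreeᵃ t) * a ! ∎
    where
    count : T (pairFreeᵃ t) → ∑ (𝟙 ∘ avoids t) (allVecs n a) ≡ a !
    count pf = begin
      ∑ (𝟙 ∘ avoids t) (allVecs n a)         ≡⟨ ∑-avoiding n a (values t) distinct-t (values-< t) ⟩
      fallingBy 1 (n ∸ length (values t)) a  ≡⟨ cong (λ m → fallingBy 1 (n ∸ m) a) (length-values t) ⟩
      fallingBy 1 a a                        ≡⟨ fallingBy-1-self a ⟩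
      a !                                    ∎
      where
      distinct-t : T (distinct (values t))
      distinct-t = proj₁ (Equivalence.to T-∧ (subst T (admissible-partners-[] (values t)) pf))

-- Bounds for the ratio fallingBy 2 n r / fallingBy 1 n r

fallingBy-suc : ∀ d A k → fallingBy d A (suc k) ≡ fallingBy d A k * (A ∸ d * k)
fallingBy-suc d A zero    = trans (*-identityʳ A) (sym (trans (+-identityʳ _) (cong (A ∸_) (*-zeroʳ d))))
fallingBy-suc d A (suc k) = begin
  A * fallingBy d (A ∸ d) (suc k)             ≡⟨ cong (A *_) (fallingBy-suc d (A ∸ d) k) ⟩
  A * (fallingBy d (A ∸ d) k * (A ∸ d ∸ d * k)) ≡⟨ *-assoc A _ _ ⟨
  A * fallingBy d (A ∸ d) k * (A ∸ d ∸ d * k)   ≡⟨ cong (A * fallingBy d (A ∸ d) k *_) (∸-+-assoc A d (d * k)) ⟩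
  A * fallingBy d (A ∸ d) k * (A ∸ (d + d * k)) ≡⟨ cong (λ e → A * fallingBy d (A ∸ d) k * (A ∸ e)) (*-suc d k) ⟨
  A * fallingBy d (A ∸ d) k * (A ∸ d * suc k)   ∎
  where open ≡-Reasoning

fallingBy-mono-≤ : ∀ {d d′ A A′} k → d′ ≤ d → A ≤ A′ → fallingBy d A k ≤ fallingBy d′ A′ k
fallingBy-mono-≤ zero    _     _     = ≤-refl
fallingBy-mono-≤ (suc k) d′≤d A≤A′ = *-mono-≤ A≤A′ (fallingBy-mono-≤ k d′≤d (∸-mono A≤A′ d′≤d))

fallingBy-1-*-! : ∀ n r → r ≤ n → fallingBy 1 n r * (n ∸ r) ! ≡ n !
fallingBy-1-*-! n       zero    _         = +-identityʳ (n !)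
fallingBy-1-*-! (suc n) (suc r) (s≤s r≤n) = trans (*-assoc (suc n) (fallingBy 1 n r) ((n ∸ r) !)) (cong (suc n *_) (fallingBy-1-*-! n r r≤n))

∸-half : ∀ n r → 2 * r ≤ n → n ∸ r ≡ n ∸ 2 * r + r
∸-half n r 2r≤n = begin
  n ∸ r                  ≡⟨ cong (_∸ r) (m∸n+n≡m 2r≤n) ⟨
  n ∸ 2 * r + 2 * r ∸ r  ≡⟨ cong (λ e → n ∸ 2 * r + e ∸ r) (solve 1 (λ r → con 2 :* r := r :+ r) refl r) ⟩
  n ∸ 2 * r + (r + r) ∸ r ≡⟨ cong (_∸ r) (+-assoc (n ∸ 2 * r) r r) ⟨
  n ∸ 2 * r + r + r ∸ r  ≡⟨ m+n∸n≡m (n ∸ 2 * r + r) r ⟩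
  n ∸ 2 * r + r          ∎
  where open ≡-Reasoning

fallingBy-1-suc : ∀ n r → 2 * r ≤ n → fallingBy 1 n (suc r) ≡ fallingBy 1 n r * (n ∸ 2 * r + r)
fallingBy-1-suc n r 2r≤n =
  trans (fallingBy-suc 1 n r) (cong (fallingBy 1 n r *_) (trans (cong (n ∸_) (*-identityˡ r)) (∸-half n r 2r≤n)))

-- In terms of the ratio: ∏_{j<r} (1 − j / (n − j)) ≥ 1 − r² / n.
fallingBy-2-1-lower : ∀ n r → 2 * r ≤ n → n * fallingBy 1 n r ≤ n * fallingBy 2 n r + r * r * fallingBy 1 n r
fallingBy-2-1-lower n zero    _        = m≤m+n (n * 1) 0
fallingBy-2-1-lower n (suc r) 2r+2≤n = begin
  n * fallingBy 1 n (suc r)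
    ≡⟨ cong (n *_) (fallingBy-1-suc n r 2r≤n) ⟩
  n * (F * (x + r))
    ≡⟨ *-assoc n F (x + r) ⟨
  n * F * (x + r)
    ≤⟨ *-monoˡ-≤ (x + r) (fallingBy-2-1-lower n r 2r≤n) ⟩
  (n * P + r * r * F) * (x + r)
    ≡⟨ solve 5 (λ n P r F x → (n :* P :+ r :* r :* F) :* (x :+ r) := n :* (P :* x) :+ (n :* r) :* P :+ r :* r :* (F :* (x :+ r))) refl n P r F x ⟩
  n * (P * x) + (n * r) * P + r * r * (F * (x + r))
    ≤⟨ +-monoˡ-≤ _ (+-monoʳ-≤ (n * (P * x)) (*-mono-≤ nr≤ (fallingBy-mono-≤ r (s≤s z≤n) ≤-refl))) ⟩
  n * (P * x) + ((2 * r + 1) * (x + r)) * F + r * r * (F * (x + r))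
    ≡⟨ solve 5 (λ n P x r F → n :* (P :* x) :+ ((con 2 :* r :+ con 1) :* (x :+ r)) :* F :+ r :* r :* (F :* (x :+ r))
                           := n :* (P :* x) :+ (con 1 :+ r) :* (con 1 :+ r) :* (F :* (x :+ r))) refl n P x r F ⟩
  n * (P * x) + suc r * suc r * (F * (x + r))
    ≡⟨ cong₂ (λ p f → n * p + suc r * suc r * f) (sym (fallingBy-suc 2 n r)) (sym (fallingBy-1-suc n r 2r≤n)) ⟩
  n * fallingBy 2 n (suc r) + suc r * suc r * fallingBy 1 n (suc r) ∎
  where
  open ≤-Reasoning
  2r≤n : 2 * r ≤ n
  2r≤n = ≤-trans (*-monoʳ-≤ 2 (n≤1+n r)) 2r+2≤n
  x : ℕ
  x = n ∸ 2 * r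
  F : ℕ
  F = fallingBy 1 n r
  P : ℕ
  P = fallingBy 2 n r
  nr≤ : n * r ≤ (2 * r + 1) * (x + r)
  nr≤ = begin
    n * r                               ≡⟨ cong (_* r) (m∸n+n≡m 2r≤n) ⟨
    (x + 2 * r) * r                     ≤⟨ m≤m+n ((x + 2 * r) * r) (x * r + x + r) ⟩
    (x + 2 * r) * r + (x * r + x + r)   ≡⟨ solve 2 (λ x r → (x :+ con 2 :* r) :* r :+ (x :* r :+ x :+ r) := (con 2 :* r :+ con 1) :* (x :+ r)) refl x r ⟩
    (2 * r + 1) * (x + r)               ∎

triangular : ℕ → ℕ
triangular zero    = 0
triangular (suc r) = triangular r + r

2*triangular+r : ∀ r → 2 * triangular r + r ≡ r * r
2*triangular+r zero    = refl
2*triangular+r (suc r) = begin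
  2 * (triangular r + r) + suc r ≡⟨ solve 2 (λ t r → con 2 :* (t :+ r) :+ (con 1 :+ r) := (con 2 :* t :+ r) :+ (con 1 :+ con 2 :* r)) refl (triangular r) r ⟩
  2 * triangular r + r + (1 + 2 * r) ≡⟨ cong (_+ (1 + 2 * r)) (2*triangular+r r) ⟩
  r * r + (1 + 2 * r)              ≡⟨ solve 1 (λ r → r :* r :+ (con 1 :+ con 2 :* r) := (con 1 :+ r) :* (con 1 :+ r)) refl r ⟩
  suc r * suc r                    ∎
  where open ≡-Reasoning

-- In terms of the ratio: ∏_{j<r} (1 − j / (n − j)) ≤ n / (n + r (r − 1) / 2).
fallingBy-2-1-upper : ∀ n r → 2 * r ≤ n → (n + triangular r) * fallingBy 2 n r ≤ n * fallingBy 1 n r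
fallingBy-2-1-upper n zero    _        = ≤-reflexive (cong (_* 1) (+-identityʳ n))
fallingBy-2-1-upper n (suc r) 2r+2≤n = begin
  (n + triangular (suc r)) * fallingBy 2 n (suc r)
    ≡⟨ cong₂ _*_ (sym (+-assoc n (triangular r) r)) (fallingBy-suc 2 n r) ⟩
  (a + r) * (P * x)
    ≡⟨ solve 4 (λ a r P x → (a :+ r) :* (P :* x) := a :* P :* x :+ r :* P :* x) refl a r P x ⟩
  a * P * x + r * P * x
    ≤⟨ +-monoʳ-≤ (a * P * x) (*-monoʳ-≤ (r * P) x≤a) ⟩
  a * P * x + r * P * a
    ≡⟨ solve 4 (λ a r P x → a :* P :* x :+ r :* P :* a := a :* P :* (x :+ r)) refl a r P x ⟩
  a * P * (x + r)
    ≤⟨ *-monoˡ-≤ (x + r) (fallingBy-2-1-upper n r 2r≤n) ⟩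
  n * F * (x + r)
    ≡⟨ *-assoc n F (x + r) ⟩
  n * (F * (x + r))
    ≡⟨ cong (n *_) (fallingBy-1-suc n r 2r≤n) ⟨
  n * fallingBy 1 n (suc r) ∎
  where
  open ≤-Reasoning
  2r≤n : 2 * r ≤ n
  2r≤n = ≤-trans (*-monoʳ-≤ 2 (n≤1+n r)) 2r+2≤n
  a : ℕ
  a = n + triangular r
  x : ℕ
  x = n ∸ 2 * r
  F : ℕ
  F = fallingBy 1 n r
  P : ℕ
  P = fallingBy 2 n r
  x≤a : x ≤ a
  x≤a = ≤-trans (m∸n≤m n (2 * r)) (m≤m+n n (triangular r))

-- Fractions of naturals in ℚ

infixl 7 _//_

_//_ : ℕ → (d : ℕ) → ⦃ NonZero d ⦄ → Q.ℚ
a // d = (ℤ.+ a) ÷ d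

toℚᵘ-// : ∀ a d ⦃ _ : NonZero d ⦄ → toℚᵘ (a // d) ≃ᵘ mkℚᵘ (ℤ.+ a) (pred d)
toℚᵘ-// a (suc d) = Q.toℚᵘ-fromℚᵘ (mkℚᵘ (ℤ.+ a) d)

//≤//⇒*≤* : ∀ a b c d ⦃ _ : NonZero b ⦄ ⦃ _ : NonZero d ⦄ → a // b Q.≤ c // d → a * d ≤ c * b
//≤//⇒*≤* a b@(suc _) c d@(suc _) a/b≤c/d
  with Qᵘ.≤-respʳ-≃ (toℚᵘ-// c d) (Qᵘ.≤-respˡ-≃ (toℚᵘ-// a b) (Q.toℚᵘ-mono-≤ a/b≤c/d))
... | *≤* ad≤cb = ℤ.drop‿+≤+ (subst₂ ℤ._≤_ (sym (ℤ.pos-* a d)) (sym (ℤ.pos-* c b)) ad≤cb)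

*≤*⇒//≤// : ∀ a b c d ⦃ _ : NonZero b ⦄ ⦃ _ : NonZero d ⦄ → a * d ≤ c * b → a // b Q.≤ c // d
*≤*⇒//≤// a b@(suc _) c d@(suc _) ad≤cb = Q.toℚᵘ-cancel-≤
  (Qᵘ.≤-respʳ-≃ (Qᵘ.≃-sym (toℚᵘ-// c d)) (Qᵘ.≤-respˡ-≃ (Qᵘ.≃-sym (toℚᵘ-// a b))
    (*≤* (subst₂ ℤ._≤_ (ℤ.pos-* a d) (ℤ.pos-* c b) (ℤ.+≤+ ad≤cb)))))

*<*⇒//<// : ∀ a b c d ⦃ _ : NonZero b ⦄ ⦃ _ : NonZero d ⦄ → a * d < c * b → a // b Q.< c // d
*<*⇒//<// a b@(suc _) c d@(suc _) ad<cb = Q.toℚᵘ-cancel-<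
  (Qᵘ.<-respʳ-≃ (Qᵘ.≃-sym (toℚᵘ-// c d)) (Qᵘ.<-respˡ-≃ (Qᵘ.≃-sym (toℚᵘ-// a b))
    (*<* (subst₂ ℤ._<_ (ℤ.pos-* a d) (ℤ.pos-* c b) (ℤ.+<+ ad<cb)))))

//-*-// : ∀ a b c d → (a // suc b) Q.* (c // suc d) ≡ (a * c) // (suc b * suc d)
//-*-// a b c d = Q.toℚᵘ-injective (Qᵘ.≃-trans (Q.toℚᵘ-homo-* (a // suc b) (c // suc d))
  (Qᵘ.≃-trans (Qᵘ.*-cong (toℚᵘ-// a (suc b)) (toℚᵘ-// c (suc d)))
  (Qᵘ.≃-trans (Qᵘ.≃-reflexive (cong (λ z → mkℚᵘ z (d + b * suc d)) (sym (ℤ.pos-* a c))))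
    (Qᵘ.≃-sym (toℚᵘ-// (a * c) (suc b * suc d))))))

∣//∣ : ∀ a b ⦃ _ : NonZero b ⦄ → Q.∣ a // b ∣ ≡ a // b
∣//∣ a b = Q.0≤p⇒∣p∣≡p (*≤*⇒//≤// 0 1 a b z≤n)

1-// : ∀ G D ⦃ _ : NonZero D ⦄ → G ≤ D → Q.1ℚ Q.- G // D ≡ (D ∸ G) // D
1-// G D@(suc D-1) G≤D = Q.toℚᵘ-injective (Qᵘ.≃-trans (Q.toℚᵘ-homo-+ Q.1ℚ (Q.- (G // D)))
  (Qᵘ.≃-trans (Qᵘ.+-cong (Qᵘ.≃-refl {toℚᵘ Q.1ℚ}) (Qᵘ.≃-trans (Q.toℚᵘ-homo‿- (G // D)) (Qᵘ.-‿cong (toℚᵘ-// G D))))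
  (Qᵘ.≃-trans (Qᵘ.≃-reflexive (cong₂ mkℚᵘ numerator (+-identityʳ D-1))) (Qᵘ.≃-sym (toℚᵘ-// (D ∸ G) D)))))
  where
  numerator : (ℤ.+ 1) ℤ.* (ℤ.+ D) ℤ.+ (ℤ.- (ℤ.+ G)) ℤ.* (ℤ.+ 1) ≡ ℤ.+ (D ∸ G)
  numerator = trans (cong₂ ℤ._+_ (ℤ.*-identityˡ (ℤ.+ D)) (ℤ.*-identityʳ (ℤ.- (ℤ.+ G)))) (trans (ℤ.m-n≡m⊖n D G) (ℤ.⊖-≥ G≤D))

positive-// : ∀ ε → Q.0ℚ Q.< ε → ∃₂ λ e q → ε ≡ suc e // suc q
positive-// ε@(mkℚ ℤ.+[1+ e ] q _) _        = e , q , sym (Q.fromℚᵘ-toℚᵘ ε)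
positive-// (mkℚ (ℤ.+ zero) _ _) (Q.*<* 0<0) = ⊥-elim (ℤ.<-irrefl refl 0<0)
positive-// (mkℚ ℤ.-[1+ _ ] _ _) (Q.*<* ())

IsLittleO1-intro : ∀ f → (∀ k → ∃[ N ] (∀ m → N ≤ m → Q.∣ f (2 * m) ∣ Q.≤ 1 // suc k)) → IsLittleO1 f
IsLittleO1-intro f small ε 0<ε with positive-// ε 0<ε
... | e , q , refl = Product.map₂ (λ ≤1/k m N≤m → Q.≤-<-trans (≤1/k m N≤m) 1/[q+2]<ε) (small (suc q))
  where
  1/[q+2]<ε : 1 // suc (suc q) Q.< suc e // suc q
  1/[q+2]<ε = *<*⇒//<// 1 (suc (suc q)) (suc e) (suc q)
    (subst (_< suc e * suc (suc q)) (sym (*-identityˡ (suc q))) (<-≤-trans (n<1+n (suc q)) (m≤n*m (suc (suc q)) (suc e))))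

module Even (m r : ℕ) (r≤m : r ≤ m) where

  n : ℕ
  n = 2 * m
  a : ℕ
  a = n ∸ r
  G : ℕ
  G = a ! * fallingBy 2 n r
  D : ℕ
  D = n !

  instance
    D≢0 : NonZero D
    D≢0 = n !≢0

  2r≤n : 2 * r ≤ n
  2r≤n = *-monoʳ-≤ 2 r≤m

  r≤n : r ≤ n
  r≤n = ≤-trans (m≤n*m r 2) 2r≤n

  D≡ : D ≡ a ! * fallingBy 1 n r
  D≡ = trans (sym (fallingBy-1-*-! n r r≤n)) (*-comm (fallingBy 1 n r) (a !))

  prob≡ : prob n r ≡ G // D
  prob≡ = cong (_// D) (#good m r r≤n)

  G≤D : G ≤ D
  G≤D = subst (G ≤_) (sym D≡) (*-monoʳ-≤ (a !) (fallingBy-mono-≤ r (s≤s z≤n) ≤-refl))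

  n*[D∸G]≤r*r*D : n * (D ∸ G) ≤ r * r * D
  n*[D∸G]≤r*r*D = begin
    n * (D ∸ G)     ≡⟨ *-distribˡ-∸ n D G ⟩
    n * D ∸ n * G   ≤⟨ m≤n+o⇒m∸n≤o (n * D) (n * G) nD≤nG+r²D ⟩
    r * r * D       ∎
    where
    open ≤-Reasoning
    P : ℕ
    P = fallingBy 2 n r
    F : ℕ
    F = fallingBy 1 n r
    nD≤nG+r²D : n * D ≤ n * G + r * r * D
    nD≤nG+r²D = begin
      n * D                         ≡⟨ cong (n *_) D≡ ⟩
      n * (a ! * F)                 ≡⟨ solve 3 (λ A n F → n :* (A :* F) := A :* (n :* F)) refl (a !) n F ⟩
      a ! * (n * F)                 ≤⟨ *-monoʳ-≤ (a !) (fallingBy-2-1-lower n r 2r≤n) ⟩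
      a ! * (n * P + r * r * F)     ≡⟨ solve 5 (λ A n P r F → A :* (n :* P :+ r :* r :* F) := n :* (A :* P) :+ r :* r :* (A :* F)) refl (a !) n P r F ⟩
      n * G + r * r * (a ! * F)     ≡⟨ cong (λ d → n * G + r * r * d) D≡ ⟨
      n * G + r * r * D             ∎

  [n+t]*G≤n*D : (n + triangular r) * G ≤ n * D
  [n+t]*G≤n*D = begin
    (n + triangular r) * (a ! * P)  ≡⟨ solve 3 (λ t A P → t :* (A :* P) := A :* (t :* P)) refl (n + triangular r) (a !) P ⟩
    a ! * ((n + triangular r) * P)  ≤⟨ *-monoʳ-≤ (a !) (fallingBy-2-1-upper n r 2r≤n) ⟩
    a ! * (n * F)                   ≡⟨ solve 3 (λ A n F → A :* (n :* F) := n :* (A :* F)) refl (a !) n F ⟩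
    n * (a ! * F)                   ≡⟨ cong (n *_) D≡ ⟨
    n * D                           ∎
    where
    open ≤-Reasoning
    P : ℕ
    P = fallingBy 2 n r
    F : ℕ
    F = fallingBy 1 n r

  module _ (0<m : 0 < m) (k : ℕ) where

    private
      K : ℕ
      K = suc k
      instance
        n≢0 : NonZero n
        n≢0 = >-nonZero (*-monoʳ-< 2 0<m)

    [D∸G]*K≤D : r * r * (K * K) ≤ n → (D ∸ G) * K ≤ D
    [D∸G]*K≤D r²K²≤n = ≤-trans (*-monoʳ-≤ (D ∸ G) (m≤m*n K K)) (*-cancelˡ-≤ n (begin
      n * ((D ∸ G) * (K * K))     ≡⟨ *-assoc n (D ∸ G) (K * K) ⟨
      n * (D ∸ G) * (K * K)       ≤⟨ *-monoˡ-≤ (K * K) n*[D∸G]≤r*r*D ⟩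
      r * r * D * (K * K)         ≡⟨ solve 3 (λ r D K → r :* r :* D :* (K :* K) := r :* r :* (K :* K) :* D) refl r D K ⟩
      r * r * (K * K) * D         ≤⟨ *-monoˡ-≤ D r²K²≤n ⟩
      n * D                       ∎))
      where open ≤-Reasoning

    G*K≤D : K * K * n ≤ r * r → G * K ≤ D
    G*K≤D K²n≤r² = *-cancelˡ-≤ n (begin
      n * (G * K)               ≡⟨ solve 3 (λ n G k → n :* (G :* (con 1 :+ k)) := (n :+ k :* n) :* G) refl n G k ⟩
      (n + k * n) * G           ≤⟨ *-monoˡ-≤ G (+-monoʳ-≤ n kn≤t) ⟩
      (n + triangular r) * G    ≤⟨ [n+t]*G≤n*D ⟩
      n * D                     ∎)
      where
      open ≤-Reasoning
      2k+1≤K*K : 2 * k + 1 ≤ K * K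
      2k+1≤K*K = begin
        2 * k + 1         ≤⟨ m≤m+n (2 * k + 1) (k * k) ⟩
        2 * k + 1 + k * k ≡⟨ solve 1 (λ k → con 2 :* k :+ con 1 :+ k :* k := (con 1 :+ k) :* (con 1 :+ k)) refl k ⟩
        K * K             ∎
      kn≤t : k * n ≤ triangular r
      kn≤t = *-cancelˡ-≤ 2 (+-cancelʳ-≤ n (2 * (k * n)) (2 * triangular r) (begin
        2 * (k * n) + n           ≡⟨ solve 2 (λ k n → con 2 :* (k :* n) :+ n := (con 2 :* k :+ con 1) :* n) refl k n ⟩
        (2 * k + 1) * n           ≤⟨ *-monoˡ-≤ n 2k+1≤K*K ⟩
        K * K * n                 ≤⟨ K²n≤r² ⟩
        r * r                     ≡⟨ 2*triangular+r r ⟨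
        2 * triangular r + r      ≤⟨ +-monoʳ-≤ (2 * triangular r) r≤n ⟩
        2 * triangular r + n      ∎))

1-prob-≤ : ∀ m r k → r ≤ m → 0 < m → r * r * (suc k * suc k) ≤ 2 * m → Q.∣ Q.1ℚ Q.- prob (2 * m) r ∣ Q.≤ 1 // suc k
1-prob-≤ m r k r≤m 0<m r²K²≤n = begin
  Q.∣ Q.1ℚ Q.- prob n r ∣  ≡⟨ cong (λ p → Q.∣ Q.1ℚ Q.- p ∣) prob≡ ⟩
  Q.∣ Q.1ℚ Q.- G // D ∣    ≡⟨ cong Q.∣_∣ (1-// G D G≤D) ⟩
  Q.∣ (D ∸ G) // D ∣       ≡⟨ ∣//∣ (D ∸ G) D ⟩
  (D ∸ G) // D             ≤⟨ *≤*⇒//≤// (D ∸ G) D 1 (suc k) (subst ((D ∸ G) * suc k ≤_) (sym (*-identityˡ D)) ([D∸G]*K≤D 0<m k r²K²≤n)) ⟩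
  1 // suc k               ∎
  where
  open Even m r r≤m
  open Q.≤-Reasoning

prob-≤ : ∀ m r k → r ≤ m → 0 < m → suc k * suc k * (2 * m) ≤ r * r → Q.∣ prob (2 * m) r ∣ Q.≤ 1 // suc k
prob-≤ m r k r≤m 0<m K²n≤r² = begin
  Q.∣ prob n r ∣  ≡⟨ cong Q.∣_∣ prob≡ ⟩
  Q.∣ G // D ∣    ≡⟨ ∣//∣ G D ⟩
  G // D          ≤⟨ *≤*⇒//≤// G D 1 (suc k) (subst (G * suc k ≤_) (sym (*-identityˡ D)) (G*K≤D 0<m k K²n≤r²)) ⟩
  1 // suc k      ∎
  where
  open Even m r r≤m
  open Q.≤-Reasoning

littleOSqrt-bound : ∀ x k n → ℕ→ℚ x Q.* ℕ→ℚ x Q.≤ 1 // suc k Q.* (1 // suc k) Q.* ℕ→ℚ n → x * x * (suc k * suc k) ≤ n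
littleOSqrt-bound x k n x²≤ = subst₂ _≤_
  (solve 2 (λ x K → x :* x :* (K :* K :* con 1) := x :* x :* (K :* K)) refl x (suc k))
  (solve 1 (λ n → con 1 :* con 1 :* n :* (con 1 :* con 1) := n) refl n)
  (//≤//⇒*≤* (x * x) (1 * 1) (1 * 1 * n) (suc k * suc k * 1)
    (subst₂ Q._≤_ (//-*-// x 0 x 0) (trans (cong (Q._* ℕ→ℚ n) (//-*-// 1 k 1 k)) (//-*-// (1 * 1) (k + k * suc k) n 0)) x²≤))

omegaSqrt-bound : ∀ K n x → ℕ→ℚ K Q.* ℕ→ℚ K Q.* ℕ→ℚ n Q.≤ ℕ→ℚ x Q.* ℕ→ℚ x → K * K * n ≤ x * x
omegaSqrt-bound K n x K²n≤ = subst₂ _≤_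
  (solve 3 (λ K n x → K :* K :* n :* con 1 := K :* K :* n) refl K n x)
  (solve 1 (λ x → x :* x :* (con 1 :* con 1 :* con 1) := x :* x) refl x)
  (//≤//⇒*≤* (K * K * n) (1 * 1 * 1) (x * x) (1 * 1)
    (subst₂ Q._≤_ (trans (cong (Q._* ℕ→ℚ n) (//-*-// K 0 K 0)) (//-*-// (K * K) 0 n 0)) (//-*-// x 0 x 0) K²n≤))

claim2p1 : (r : ℕ → ℕ) → (∀ m → r (2 * m) ≤ m) →
    (LittleOSqrt r → IsLittleO1 (λ n → Q.1ℚ Q.- prob n (r n))) ×
    (OmegaSqrt r → IsLittleO1 (λ n → prob n (r n)))
claim2p1 r r≤ =
    (λ o → IsLittleO1-intro (λ n → Q.1ℚ Q.- prob n (r n)) (1-prob-small o))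
  , (λ ω → IsLittleO1-intro (λ n → prob n (r n)) (prob-small ω))
  where
  1-prob-small : LittleOSqrt r → ∀ k → ∃[ N ] (∀ m → N ≤ m → Q.∣ Q.1ℚ Q.- prob (2 * m) (r (2 * m)) ∣ Q.≤ 1 // suc k)
  1-prob-small o k = Product.map suc (λ {N} r²≤ → λ where
      (suc m) (s≤s N≤m) → 1-prob-≤ (suc m) (r (2 * suc m)) k (r≤ (suc m)) (s≤s z≤n)
                            (littleOSqrt-bound (r (2 * suc m)) k (2 * suc m) (r²≤ (suc m) (m≤n⇒m≤1+n N≤m))))
    (o (1 // suc k) (*<*⇒//<// 0 1 1 (suc k) (s≤s z≤n)))
  prob-small : OmegaSqrt r → ∀ k → ∃[ N ] (∀ m → N ≤ m → Q.∣ prob (2 * m) (r (2 * m)) ∣ Q.≤ 1 // suc k)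
  prob-small ω k = Product.map suc (λ {N} r²≥ → λ where
      (suc m) (s≤s N≤m) → prob-≤ (suc m) (r (2 * suc m)) k (r≤ (suc m)) (s≤s z≤n)
                            (omegaSqrt-bound (suc k) (2 * suc m) (r (2 * suc m)) (r²≥ (suc m) (m≤n⇒m≤1+n N≤m))))
    (ω (suc k // 1) (*<*⇒//<// 0 1 (suc k) 1 (s≤s z≤n)))
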